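{- Let $n\ge1$, $B\in\mathrm{Int}(n)$ and let $i$ be an integer with $0\le i\le \dim(B)$. Then $\psi(\mathrm{add}(B,i))=(B,i)$. If moreover $n>1$, then $\mathrm{add}(\psi(B))=B$, i.e. $\mathrm{add}(f(B),\mathrm{index}(B)-1)=B$.
   Context: For $n\in\mathbb{N}$, $\mathrm{Int}(n)$ denotes the set of upper triangular square matrices with non-negative integer entries summing to $n$ such that every row and every column contains at least one non-zero entry. For such $A$ let $\dim(A)$ be the number of rows, $\mathrm{index}(A)$ the smallest $i$ with $A_{i,\dim(A)}>0$, and $\mathrm{val}(A)=A_{\mathrm{index}(A),\dim(A)}$. Removal operation $f$ on $A\in\mathrm{Int}(n)$, $n\ge2$: (Rem1) if $\mathrm{val}(A)>1$, or if $\mathrm{val}(A)=1$, $\mathrm{index}(A)<\dim(A)$ and row $\mathrm{index}(A)$ has another positive entry, then $f(A)$ is $A$ with entry $(\mathrm{index}(A),\dim(A))$ decreased by $1$; (Rem2) if $\mathrm{val}(A)=1$ and $\mathrm{index}(A)=\dim(A)$, $f(A)$ is $A$ with last row and last column deleted; (Rem3) if $\mathrm{val}(A)=1$, $\mathrm{index}(A)<\dim(A)$ and all other entries of row $\mathrm{index}(A)$ are $0$, set $A_{i,\dim(A)}:=A_{i,\mathrm{index}(A)}$ for $1\le i\le\mathrm{index}(A)-1$ and then delete row and column $\mathrm{index}(A)$. Define $\psi(A)=(f(A),\mathrm{index}(A)-1)$. Addition operation, for $A\in\mathrm{Int}(n)$ and integer $m\in[0,\dim(A)]$: (Add1) if $0\le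 m\le\mathrm{index}(A)-1$, $\mathrm{add}(A,m)$ is $A$ with entry $(m+1,\dim(A))$ increased by $1$; (Add2) if $m=\dim(A)$, $\mathrm{add}(A,m)=\begin{pmatrix}A&0\\0&1\end{pmatrix}$; (Add3) if $\mathrm{index}(A)\le m<\dim(A)$, insert a new row between rows $m$ and $m+1$ and a new column between columns $m$ and $m+1$, fill the new row with zeros except a $1$ in the last column, move the entries of the last column in rows $1,\dots,m$ into the new column (same rows) replacing them by $0$ in the last column, and set all other entries of the new column to $0$. For a pair $(C,m)$ write $\mathrm{add}((C,m))=\mathrm{add}(C,m)$. -}

module Defs where

open import Data.Nat using (ℕ; zero; suc; _∸_; _<_; _<ᵇ_; _≡ᵇ_; pred)
open import Data.Bool using (Bool; true; false; if_then_else_; _∧_; _∨_)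
open import Data.List using (List; []; _∷_; _++_; [_]; length; map; take; drop; replicate)
open import Data.Nat.ListAction using (sum)
open import Data.List.Relation.Unary.All using (All)
open import Data.Product using (_×_; _,_; Σ; ∃)
open import Relation.Binary.PropositionalEquality using (_≡_)

-- A matrix is a list of rows; each row is a list of natural numbers.
-- Positions (rows/columns) inside the helper functions below are 0-based;
-- the paper's 1-based row i is position i ∸ 1.
Mat : Set
Mat = List (List ℕ)

-- entry of a row at a 0-based position (0 if out of range)
get : List ℕ → ℕ → ℕ
get []       _       = 0
get (x ∷ xs) zero    = x
get (x ∷ xs) (suc k) = get xs k

getRow : Mat → ℕ → List ℕ
getRow []       _       = []
getRow (r ∷ rs) zero    = r
getRow (r ∷ rs) (suc k) = getRow rs k

at : Mat → ℕ → ℕ → ℕ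
at A p q = get (getRow A p) q

upd : {X : Set} → List X → ℕ → (X → X) → List X
upd []       _       g = []
upd (x ∷ xs) zero    g = g x ∷ xs
upd (x ∷ xs) (suc k) g = x ∷ upd xs k g

del : {X : Set} → List X → ℕ → List X
del []       _       = []
del (x ∷ xs) zero    = xs
del (x ∷ xs) (suc k) = x ∷ del xs k

imapFrom : {X Y : Set} → ℕ → (ℕ → X → Y) → List X → List Y
imapFrom p g []       = []
imapFrom p g (x ∷ xs) = g p x ∷ imapFrom (suc p) g xs

imap : {X Y : Set} → (ℕ → X → Y) → List X → List Y
imap = imapFrom 0

dim : Mat → ℕ
dim A = length A

record InInt (n : ℕ) (A : Mat) : Set where
  field
    square     : All (λ r → length r ≡ dim A) A
    upperTri   : ∀ p q → p < dim A → q < p → at A p q ≡ 0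
    sumIs      : sum (map sum A) ≡ n
    rowNonzero : ∀ p → p < dim A → ∃ λ q → q < dim A × 0 < at A p q
    colNonzero : ∀ q → q < dim A → ∃ λ p → p < dim A × 0 < at A p q

firstPos : (List ℕ → Bool) → Mat → ℕ
firstPos P []       = 0
firstPos P (r ∷ rs) = if P r then 0 else suc (firstPos P rs)

-- smallest (1-based) i with A_{i,dim A} > 0
index : Mat → ℕ
index A = suc (firstPos (λ r → 0 <ᵇ get r (dim A ∸ 1)) A)

val : Mat → ℕ
val A = at A (index A ∸ 1) (dim A ∸ 1)

anyPos : List ℕ → Bool
anyPos []       = false
anyPos (x ∷ xs) = (0 <ᵇ x) ∨ anyPos xs

otherPos : List ℕ → ℕ → Bool
otherPos []       _       = false
otherPos (x ∷ xs) zero    = anyPos xs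
otherPos (x ∷ xs) (suc k) = (0 <ᵇ x) ∨ otherPos xs k

rem1 : Mat → Mat
rem1 A = upd A (index A ∸ 1) (λ r → upd r (dim A ∸ 1) pred)

rem2 : Mat → Mat
rem2 A = map (λ r → take (dim A ∸ 1) r) (take (dim A ∸ 1) A)

rem3 : Mat → Mat
rem3 A = map (λ r → del r q) (del A' q)
  where
    q  = index A ∸ 1
    A' = imap (λ p r → if p <ᵇ q then upd r (dim A ∸ 1) (λ _ → get r q) else r) A

f : Mat → Mat
f A =
  if (1 <ᵇ val A) ∨ ((val A ≡ᵇ 1) ∧ (index A <ᵇ dim A)
                     ∧ otherPos (getRow A (index A ∸ 1)) (dim A ∸ 1))
  then rem1 A
  else if (val A ≡ᵇ 1) ∧ (index A ≡ᵇ dim A)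
  then rem2 A
  else if (val A ≡ᵇ 1) ∧ (index A <ᵇ dim A)
  then rem3 A
  else A   -- val A = 0: cannot happen for A ∈ Int(n)

ψ : Mat → Mat × ℕ
ψ A = f A , index A ∸ 1

add3 : Mat → ℕ → Mat
add3 A m = take m rows' ++ [ replicate (dim A) 0 ++ [ 1 ] ] ++ drop m rows'
  where
    d = dim A
    rows' = imap (λ p r → if p <ᵇ m
                           then take m r ++ [ get r (d ∸ 1) ] ++ upd (drop m r) (d ∸ 1 ∸ m) (λ _ → 0)
                           else take m r ++ [ 0 ] ++ drop m r) A

add : Mat → ℕ → Mat
add A m =
  if m <ᵇ index A
  then upd A m (λ r → upd r (dim A ∸ 1) suc)
  else if m ≡ᵇ dim A
  then map (λ r → r ++ [ 0 ]) A ++ [ replicate (dim A) 0 ++ [ 1 ] ]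
  else if m <ᵇ dim A
  then add3 A m
  else A   -- m > dim A: outside the domain

addP : Mat × ℕ → Mat
addP (C , m) = add C m

module Submission where

-- Let e be the last column and rk the pivot row, the first row with a positive entry in column e, so
-- that B = B1 ++ rk ∷ B2 with column e of B1 zero.  Each addition case makes the row it touches the
-- pivot row of add B i, and its value together with the presence of other positive entries in that
-- row selects the matching removal case, which undoes the addition row by row.  Conversely, each
-- removal case leaves a matrix whose index lies on the side of index B ∸ 1 that makes add choose the
-- inverse addition case: after Rem1 the rows of B1 still vanish in column e, while after Rem2 and Rem3
-- the column that becomes the new last column has, by upper triangularity and because no column of
-- B is zero, a positive entry above the pivot row.  The hypothesis n > 1 only excludes B = [[1]],
-- which Rem2 turns into the empty matrix.

open import Defs
open import Data.Nat using (ℕ; zero; suc; _+_; _∸_; _≤_; _<_; _<ᵇ_; _≡ᵇ_; pred; z≤n; s≤s; z<s; s<s; >-nonZero)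
open import Data.Nat.ListAction using (sum)
open import Data.Nat.Properties
open import Data.Bool using (Bool; true; false; if_then_else_; _∧_; _∨_)
open import Data.Bool.Properties using (T-≡; ¬-not)
open import Data.List using (List; []; _∷_; _++_; [_]; length; map; take; drop; replicate)
open import Data.List.Properties using (length-++; length-map; map-++; map-∘; map-id; map-id-local; take++drop≡id; length-take; length-++-≤ˡ; ++-identityʳ)
open import Data.List.Relation.Unary.All as All using (All; []; _∷_)
open import Data.List.Relation.Unary.All.Properties using (++⁻ˡ; ++⁻ʳ; map⁺)
open import Data.Product using (_×_; _,_; Σ)
open import Data.Sum as Sum using (_⊎_; inj₁; inj₂)
open import Function using (_∘_; const)
open import Function.Bundles using (Equivalence)
open import Relation.Nullary using (contradiction)
open import Relation.Binary.Definitions using (Tri; tri<; tri≈; tri>)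
open import Relation.Binary.PropositionalEquality hiding ([_])
open ≡-Reasoning

<ᵇ-true : ∀ {m n} → m < n → (m <ᵇ n) ≡ true
<ᵇ-true m<n = Equivalence.to T-≡ (<⇒<ᵇ m<n)

<ᵇ-false : ∀ {m n} → n ≤ m → (m <ᵇ n) ≡ false
<ᵇ-false {m} {n} n≤m = ¬-not (λ eq → <⇒≱ (<ᵇ⇒< m n (Equivalence.from T-≡ eq)) n≤m)

≡ᵇ-refl : ∀ m → (m ≡ᵇ m) ≡ true
≡ᵇ-refl m = Equivalence.to T-≡ (≡⇒≡ᵇ m m refl)

≡ᵇ-false : ∀ {m n} → m ≢ n → (m ≡ᵇ n) ≡ false
≡ᵇ-false {m} {n} m≢n = ¬-not (λ eq → m≢n (≡ᵇ⇒≡ m n (Equivalence.from T-≡ eq)))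

module _ {X : Set} {x y : X} where
  if-true : ∀ {b} → b ≡ true → (if b then x else y) ≡ x
  if-true refl = refl

  if-false : ∀ {b} → b ≡ false → (if b then x else y) ≡ y
  if-false refl = refl

module _ {X : Set} where
  upd-mid : ∀ (a : List X) x z h → upd (a ++ x ∷ z) (length a) h ≡ a ++ h x ∷ z
  upd-mid []      x z h = refl
  upd-mid (w ∷ a) x z h = cong (w ∷_) (upd-mid a x z h)

  upd-upd : ∀ (xs : List X) j g h → upd (upd xs j g) j h ≡ upd xs j (h ∘ g)
  upd-upd []       j       g h = refl
  upd-upd (x ∷ xs) zero    g h = refl
  upd-upd (x ∷ xs) (suc j) g h = cong (x ∷_) (upd-upd xs j g h)

  del-mid : ∀ (a : List X) x z {k} → length a ≡ k → del (a ++ x ∷ z) k ≡ a ++ z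
  del-mid []      x z refl = refl
  del-mid (w ∷ a) x z refl = cong (w ∷_) (del-mid a x z refl)

  take-++ : ∀ (a z : List X) {m} → length a ≡ m → take m (a ++ z) ≡ a
  take-++ []      z refl = refl
  take-++ (x ∷ a) z refl = cong (x ∷_) (take-++ a z refl)

  drop-++ : ∀ (a z : List X) {m} → length a ≡ m → drop m (a ++ z) ≡ z
  drop-++ []      z refl = refl
  drop-++ (x ∷ a) z refl = drop-++ a z refl

  length-mid : ∀ (a : List X) x y z → length (a ++ x ∷ z) ≡ length (a ++ y ∷ z)
  length-mid a x y z = trans (length-++ a) (sym (length-++ a))

  length-snoc : ∀ (a : List X) x → length (a ++ [ x ]) ≡ suc (length a)
  length-snoc []      x = refl
  length-snoc (w ∷ a) x = cong suc (length-snoc a x)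

  split-≤ : ∀ (xs : List X) i → i ≤ length xs → Σ (List X) λ a → Σ (List X) λ z → xs ≡ a ++ z × length a ≡ i
  split-≤ xs i i≤n = take i xs , drop i xs , sym (take++drop≡id i xs) , trans (length-take i xs) (m≤n⇒m⊓n≡m i≤n)

  split-at : ∀ (xs : List X) i → i < length xs →
    Σ (List X) λ a → Σ X λ x → Σ (List X) λ z → xs ≡ a ++ x ∷ z × length a ≡ i
  split-at (x ∷ xs) zero    _         = [] , x , xs , refl , refl
  split-at (x ∷ xs) (suc i) (s≤s i<n) with split-at xs i i<n
  ... | a , y , z , refl , refl = x ∷ a , y , z , refl , refl

  module _ {Y : Set} (g h : X → Y) where
    imapFrom-if-≥ : ∀ m s (z : List X) → m ≤ s →
      imapFrom s (λ p r → if p <ᵇ m then g r else h r) z ≡ map h z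
    imapFrom-if-≥ m s []      _   = refl
    imapFrom-if-≥ m s (r ∷ z) m≤s =
      cong₂ _∷_ (if-false (<ᵇ-false m≤s)) (imapFrom-if-≥ m (suc s) z (m≤n⇒m≤1+n m≤s))

    imapFrom-if : ∀ m s (a z : List X) → s + length a ≡ m →
      imapFrom s (λ p r → if p <ᵇ m then g r else h r) (a ++ z) ≡ map g a ++ map h z
    imapFrom-if m s []      z eq = imapFrom-if-≥ m s z (≤-reflexive (trans (sym eq) (+-identityʳ s)))
    imapFrom-if m s (r ∷ a) z eq =
      cong₂ _∷_ (if-true (<ᵇ-true (subst (s <_) eq (m<m+n s z<s))))
                (imapFrom-if m (suc s) a z (trans (sym (+-suc s (length a))) eq))

All-getRow : ∀ {Q : List ℕ → Set} (A : Mat) p → All Q A → p < length A → Q (getRow A p)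
All-getRow (r ∷ A) zero    (q ∷ _)  _         = q
All-getRow (r ∷ A) (suc p) (_ ∷ qs) (s≤s p<n) = All-getRow A p qs p<n

All-getRow⁺ : ∀ {Q : List ℕ → Set} (A : Mat) → (∀ p → p < length A → Q (getRow A p)) → All Q A
All-getRow⁺ []      _ = []
All-getRow⁺ (r ∷ A) H = H zero z<s ∷ All-getRow⁺ A (λ p p<n → H (suc p) (s<s p<n))

getRow-mid : ∀ (a : Mat) x z {k} → length a ≡ k → getRow (a ++ x ∷ z) k ≡ x
getRow-mid []      x z refl = refl
getRow-mid (w ∷ a) x z refl = getRow-mid a x z refl

getRow-++ˡ : ∀ (a z : Mat) p → p < length a → getRow (a ++ z) p ≡ getRow a p
getRow-++ˡ (x ∷ a) z zero    _         = refl
getRow-++ˡ (x ∷ a) z (suc p) (s≤s p<n) = getRow-++ˡ a z p p<n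

getRow-++ʳ : ∀ (a z : Mat) j → getRow (a ++ z) (length a + j) ≡ getRow z j
getRow-++ʳ []      z j = refl
getRow-++ʳ (x ∷ a) z j = getRow-++ʳ a z j

getRow-map : ∀ g (a : Mat) p → p < length a → getRow (map g a) p ≡ g (getRow a p)
getRow-map g (x ∷ a) zero    _         = refl
getRow-map g (x ∷ a) (suc p) (s≤s p<n) = getRow-map g a p p<n

ColumnZero : ℕ → Mat → Set
ColumnZero q = All (λ r → get r q ≡ 0)

Width : ℕ → Mat → Set
Width w = All (λ r → length r ≡ w)

unitRow : ℕ → List ℕ
unitRow m = replicate m 0 ++ [ 1 ]

get-mid : ∀ (a : List ℕ) x z {k} → length a ≡ k → get (a ++ x ∷ z) k ≡ x
get-mid []      x z refl = refl
get-mid (w ∷ a) x z refl = get-mid a x z refl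

get-upd : ∀ (r : List ℕ) j g → j < length r → get (upd r j g) j ≡ g (get r j)
get-upd (x ∷ r) zero    g _         = refl
get-upd (x ∷ r) (suc j) g (s≤s j<n) = get-upd r j g j<n

upd-fix : ∀ (r : List ℕ) j φ → φ (get r j) ≡ get r j → upd r j φ ≡ r
upd-fix []      j       φ _  = refl
upd-fix (x ∷ r) zero    φ eq = cong (_∷ r) eq
upd-fix (x ∷ r) (suc j) φ eq = cong (x ∷_) (upd-fix r j φ eq)

get-take : ∀ (r : List ℕ) m q → q < m → get (take m r) q ≡ get r q
get-take []      (suc m) q       _         = refl
get-take (x ∷ r) (suc m) zero    _         = refl
get-take (x ∷ r) (suc m) (suc q) (s≤s q<m) = get-take r m q q<m

take-∷ʳ-last : ∀ (r : List ℕ) m → length r ≡ suc m → get r m ≡ 0 → take m r ++ [ 0 ] ≡ r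
take-∷ʳ-last (x ∷ [])    zero    _  eq = cong [_] (sym eq)
take-∷ʳ-last (x ∷ y ∷ r) (suc m) ln eq = cong (x ∷_) (take-∷ʳ-last (y ∷ r) m (suc-injective ln) eq)

get-unitRow : ∀ m → get (unitRow m) m ≡ 1
get-unitRow zero    = refl
get-unitRow (suc m) = get-unitRow m

≡unitRow : ∀ (r : List ℕ) m → length r ≡ suc m → (∀ q → q < m → get r q ≡ 0) → get r m ≡ 1 →
  r ≡ unitRow m
≡unitRow (x ∷ [])    zero    _  _     one = cong [_] one
≡unitRow (x ∷ y ∷ r) (suc m) ln zeros one =
  cong₂ _∷_ (zeros 0 z<s) (≡unitRow (y ∷ r) m (suc-injective ln) (λ q q<m → zeros (suc q) (s<s q<m)) one)

anyPos-intro : ∀ (r : List ℕ) q → 0 < get r q → anyPos r ≡ true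
anyPos-intro (suc x ∷ r) zero    _   = refl
anyPos-intro (x ∷ r)     (suc q) pos with 0 <ᵇ x
... | true  = refl
... | false = anyPos-intro r q pos

anyPos-elim : ∀ (r : List ℕ) q → anyPos r ≡ false → get r q ≡ 0
anyPos-elim []          q       _  = refl
anyPos-elim (zero ∷ r)  zero    _  = refl
anyPos-elim (zero ∷ r)  (suc q) eq = anyPos-elim r q eq
anyPos-elim (suc x ∷ r) q       ()

otherPos-intro : ∀ (r : List ℕ) q k → q ≢ k → 0 < get r q → otherPos r k ≡ true
otherPos-intro (x ∷ r)     zero    zero    q≢k _   = contradiction refl q≢k
otherPos-intro (suc x ∷ r) zero    (suc k) _   _   = refl
otherPos-intro (x ∷ r)     (suc q) zero    _   pos = anyPos-intro r q pos
otherPos-intro (x ∷ r)     (suc q) (suc k) q≢k pos with 0 <ᵇ x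
... | true  = refl
... | false = otherPos-intro r q k (q≢k ∘ cong suc) pos

otherPos-elim : ∀ (r : List ℕ) q k → q ≢ k → otherPos r k ≡ false → get r q ≡ 0
otherPos-elim []          q       k       _   _  = refl
otherPos-elim (x ∷ r)     zero    zero    q≢k _  = contradiction refl q≢k
otherPos-elim (zero ∷ r)  zero    (suc k) _   _  = refl
otherPos-elim (x ∷ r)     (suc q) zero    _   eq = anyPos-elim r q eq
otherPos-elim (zero ∷ r)  (suc q) (suc k) q≢k eq = otherPos-elim r q k (q≢k ∘ cong suc) eq
otherPos-elim (suc x ∷ r) q       (suc k) _   ()

otherPos-upd : ∀ (r : List ℕ) k g → otherPos (upd r k g) k ≡ otherPos r k
otherPos-upd []      k       g = refl
otherPos-upd (x ∷ r) zero    g = refl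
otherPos-upd (x ∷ r) (suc k) g = cong ((0 <ᵇ x) ∨_) (otherPos-upd r k g)

otherPos-unitRow : ∀ m → otherPos (unitRow m) m ≡ false
otherPos-unitRow zero    = refl
otherPos-unitRow (suc m) = otherPos-unitRow m

-- Add3 applies moveLastInto to the rows above the new row and insertAt to those below;
-- Rem3 applies moveIntoLast to the rows above the deleted row.

insertAt : ℕ → ℕ → List ℕ → List ℕ
insertAt i x r = take i r ++ x ∷ drop i r

moveLastInto : ℕ → ℕ → List ℕ → List ℕ
moveLastInto i e r = take i r ++ get r e ∷ upd (drop i r) (e ∸ i) (const 0)

moveIntoLast : ℕ → ℕ → List ℕ → List ℕ
moveIntoLast q e r = del (upd r e (const (get r q))) q

del-insertAt : ∀ (r : List ℕ) i x → i ≤ length r → del (insertAt i x r) i ≡ r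
del-insertAt r       zero    x _         = refl
del-insertAt (y ∷ r) (suc i) x (s≤s i≤n) = cong (y ∷_) (del-insertAt r i x i≤n)

insertAt-del : ∀ (r : List ℕ) k → k < length r → get r k ≡ 0 → insertAt k 0 (del r k) ≡ r
insertAt-del (x ∷ r) zero    _         eq = cong (_∷ r) (sym eq)
insertAt-del (x ∷ r) (suc k) (s≤s k<n) eq = cong (x ∷_) (insertAt-del r k k<n eq)

get-moveLastInto : ∀ (r : List ℕ) i e → i ≤ e → e < length r → get (moveLastInto i e r) (suc e) ≡ 0
get-moveLastInto r       zero    e       _         e<n       = get-upd r e (const 0) e<n
get-moveLastInto (x ∷ r) (suc i) (suc e) (s≤s i≤e) (s≤s e<n) = get-moveLastInto r i e i≤e e<n

moveIntoLast-moveLastInto : ∀ (r : List ℕ) i e → i ≤ e → e < length r →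
  moveIntoLast i (suc e) (moveLastInto i e r) ≡ r
moveIntoLast-moveLastInto r zero e _ _ = begin
  upd (upd r e (const 0)) e (const (get r e)) ≡⟨ upd-upd r e (const 0) (const (get r e)) ⟩
  upd r e (const (get r e))                   ≡⟨ upd-fix r e _ refl ⟩
  r                                           ∎
moveIntoLast-moveLastInto (x ∷ r) (suc i) (suc e) (s≤s i≤e) (s≤s e<n) =
  cong (x ∷_) (moveIntoLast-moveLastInto r i e i≤e e<n)

get-moveIntoLast : ∀ (r : List ℕ) k e → k ≤ e → suc e < length r → get (moveIntoLast k (suc e) r) e ≡ get r k
get-moveIntoLast (y ∷ r) zero    e       _         (s≤s e<n) = get-upd r e (const y) e<n
get-moveIntoLast (y ∷ r) (suc k) (suc e) (s≤s k≤e) (s≤s e<n) = get-moveIntoLast r k e k≤e e<n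

moveLastInto-moveIntoLast : ∀ (r : List ℕ) k e → k ≤ e → suc e < length r → get r (suc e) ≡ 0 →
  moveLastInto k e (moveIntoLast k (suc e) r) ≡ r
moveLastInto-moveIntoLast (y ∷ r) zero e _ (s≤s e<n) last0 = cong₂ _∷_
  (get-upd r e (const y) e<n)
  (begin
    upd (upd r e (const y)) e (const 0) ≡⟨ upd-upd r e (const y) (const 0) ⟩
    upd r e (const 0)                   ≡⟨ upd-fix r e _ (sym last0) ⟩
    r                                   ∎)
moveLastInto-moveIntoLast (y ∷ r) (suc k) (suc e) (s≤s k≤e) (s≤s e<n) last0 =
  cong (y ∷_) (moveLastInto-moveIntoLast r k e k≤e e<n last0)

positiveAt : ℕ → List ℕ → Bool
positiveAt e r = 0 <ᵇ get r e

firstPos-++ : ∀ P (a z : Mat) → All (λ r → P r ≡ false) a → firstPos P (a ++ z) ≡ length a + firstPos P z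
firstPos-++ P []      z []       = refl
firstPos-++ P (r ∷ a) z (p ∷ ps) = trans (if-false p) (cong suc (firstPos-++ P a z ps))

firstPos-≤ : ∀ P (A : Mat) p → p < length A → P (getRow A p) ≡ true → firstPos P A ≤ p
firstPos-≤ P (r ∷ A) zero    _         Pr = ≤-reflexive (if-true Pr)
firstPos-≤ P (r ∷ A) (suc p) (s≤s p<n) Pr with P r
... | true  = z≤n
... | false = s≤s (firstPos-≤ P A p p<n Pr)

index-by-column : ∀ {e} (A : Mat) → dim A ≡ suc e → index A ≡ suc (firstPos (positiveAt e) A)
index-by-column A d = cong (λ d → suc (firstPos (positiveAt (d ∸ 1)) A)) d

index-above : ∀ {e} (a z : Mat) → dim (a ++ z) ≡ suc e → ColumnZero e a →
  index (a ++ z) ≡ suc (length a + firstPos (positiveAt e) z)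
index-above a z d zeros =
  trans (index-by-column (a ++ z) d) (cong suc (firstPos-++ _ a z (All.map (cong (0 <ᵇ_)) zeros)))

index-pivot : ∀ {e} (a : Mat) r z → dim (a ++ r ∷ z) ≡ suc e → ColumnZero e a → 0 < get r e →
  index (a ++ r ∷ z) ≡ suc (length a)
index-pivot a r z d zeros pos = begin
  index (a ++ r ∷ z)                                ≡⟨ index-above a (r ∷ z) d zeros ⟩
  suc (length a + firstPos (positiveAt _) (r ∷ z))  ≡⟨ cong (λ j → suc (length a + j)) (if-true (<ᵇ-true pos)) ⟩
  suc (length a + 0)                                ≡⟨ cong suc (+-identityʳ (length a)) ⟩
  suc (length a)                                    ∎

val-pivot : ∀ {e} (a : Mat) r z → dim (a ++ r ∷ z) ≡ suc e → ColumnZero e a → 0 < get r e →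
  val (a ++ r ∷ z) ≡ get r e
val-pivot a r z d zeros pos =
  trans (cong₂ (λ i d → get (getRow (a ++ r ∷ z) (i ∸ 1)) (d ∸ 1)) (index-pivot a r z d zeros pos) d)
        (cong (λ r → get r _) (getRow-mid a r z refl))

index-≤ : ∀ {e} (A : Mat) p → dim A ≡ suc e → p < dim A → 0 < get (getRow A p) e → index A ≤ suc p
index-≤ A p d p<n pos =
  ≤-trans (≤-reflexive (index-by-column A d)) (s≤s (firstPos-≤ _ A p p<n (<ᵇ-true pos)))

removalCase : ℕ → ℕ → ℕ → Bool → Mat → Mat
removalCase v ix d other A =
  if (1 <ᵇ v) ∨ ((v ≡ᵇ 1) ∧ (ix <ᵇ d) ∧ other) then rem1 A
  else if (v ≡ᵇ 1) ∧ (ix ≡ᵇ d) then rem2 A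
  else if (v ≡ᵇ 1) ∧ (ix <ᵇ d) then rem3 A
  else A

f≡removalCase : ∀ A {v k e} → val A ≡ v → index A ≡ suc k → dim A ≡ suc e →
  f A ≡ removalCase v (suc k) (suc e) (otherPos (getRow A k) e) A
f≡removalCase A refl ix d = cong₂ (λ i d → removalCase (val A) i d (otherPos (getRow A (i ∸ 1)) (d ∸ 1)) A) ix d

f≡rem1 : ∀ A {k e} → index A ≡ suc k → dim A ≡ suc e →
  1 < val A ⊎ (val A ≡ 1 × k < e × otherPos (getRow A k) e ≡ true) → f A ≡ rem1 A
f≡rem1 A {k} {e} ix d cond = trans (f≡removalCase A refl ix d) (rem1-case (val A) cond)
  where
    rem1-case : ∀ v {b} → 1 < v ⊎ (v ≡ 1 × k < e × b ≡ true) → removalCase v (suc k) (suc e) b A ≡ rem1 A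
    rem1-case (suc (suc v)) _                        = refl
    rem1-case 1             (inj₂ (_ , k<e , refl)) = if-true (cong (_∧ true) (<ᵇ-true k<e))
    rem1-case 1             (inj₁ (s≤s ()))
    rem1-case 0             (inj₁ ())
    rem1-case 0             (inj₂ (() , _))

f≡rem2 : ∀ A {e} → val A ≡ 1 → index A ≡ suc e → dim A ≡ suc e → f A ≡ rem2 A
f≡rem2 A {e} v ix d = trans (f≡removalCase A v ix d)
  (trans (if-false (cong (_∧ otherPos (getRow A e) e) (<ᵇ-false (≤-refl {e})))) (if-true (≡ᵇ-refl e)))

f≡rem3 : ∀ A {k e} → val A ≡ 1 → index A ≡ suc k → dim A ≡ suc e → k < e →
  otherPos (getRow A k) e ≡ false → f A ≡ rem3 A
f≡rem3 A {k} {e} v ix d k<e other = trans (f≡removalCase A v ix d) (rem3-case other)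
  where
    rem3-case : ∀ {b} → b ≡ false → removalCase 1 (suc k) (suc e) b A ≡ rem3 A
    rem3-case refl = trans (if-false (cong (_∧ false) (<ᵇ-true k<e)))
                           (trans (if-false (≡ᵇ-false (<⇒≢ k<e))) (if-true (<ᵇ-true k<e)))

add≡add1 : ∀ {A m} → m < index A → add A m ≡ upd A m (λ r → upd r (dim A ∸ 1) suc)
add≡add1 m<ix = if-true (<ᵇ-true m<ix)

add≡add2 : ∀ {A} → index A ≤ dim A → add A (dim A) ≡ map (_++ [ 0 ]) A ++ [ unitRow (dim A) ]
add≡add2 {A} ix≤d = trans (if-false (<ᵇ-false ix≤d)) (if-true (≡ᵇ-refl (dim A)))

add≡add3 : ∀ {A m} → index A ≤ m → m < dim A → add A m ≡ add3 A m
add≡add3 ix≤m m<d = trans (if-false (<ᵇ-false ix≤m)) (trans (if-false (≡ᵇ-false (<⇒≢ m<d))) (if-true (<ᵇ-true m<d)))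

add3-split : ∀ {e m} (Ba Bc : Mat) → length Ba ≡ m → dim (Ba ++ Bc) ≡ suc e →
  add3 (Ba ++ Bc) m ≡ map (moveLastInto m e) Ba ++ unitRow (suc e) ∷ map (insertAt m 0) Bc
add3-split {e} {m} Ba Bc refl d = begin
  take m rows ++ unitRow (dim B) ∷ drop m rows
    ≡⟨ cong (λ R → take m R ++ unitRow (dim B) ∷ drop m R)
            (imapFrom-if (moveLastInto m (dim B ∸ 1)) (insertAt m 0) m 0 Ba Bc refl) ⟩
  take m (above ++ below) ++ unitRow (dim B) ∷ drop m (above ++ below)
    ≡⟨ cong₂ (λ X Y → X ++ unitRow (dim B) ∷ Y) (take-++ above below (length-map _ Ba))
                                                (drop-++ above below (length-map _ Ba)) ⟩
  above ++ unitRow (dim B) ∷ below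
    ≡⟨ cong (λ d → map (moveLastInto m (d ∸ 1)) Ba ++ unitRow d ∷ below) d ⟩
  map (moveLastInto m e) Ba ++ unitRow (suc e) ∷ below ∎
  where
    B = Ba ++ Bc
    above = map (moveLastInto m (dim B ∸ 1)) Ba
    below = map (insertAt m 0) Bc
    rows = imap (λ p r → if p <ᵇ m then moveLastInto m (dim B ∸ 1) r else insertAt m 0 r) B

rem3At : ℕ → ℕ → Mat → Mat
rem3At q d A = map (λ r → del r q) (del (imap (λ p r → if p <ᵇ q then upd r d (const (get r q)) else r) A) q)

rem3-split : ∀ {e k} (B1 : Mat) rk B2 → length B1 ≡ k →
  index (B1 ++ rk ∷ B2) ≡ suc k → dim (B1 ++ rk ∷ B2) ≡ suc e →
  rem3 (B1 ++ rk ∷ B2) ≡ map (moveIntoLast k e) B1 ++ map (λ r → del r k) B2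
rem3-split {e} {k} B1 rk B2 refl ix d = begin
  rem3 B
    ≡⟨ cong₂ (λ i d → rem3At (i ∸ 1) (d ∸ 1) B) ix d ⟩
  map (λ r → del r k) (del (imap (λ p r → if p <ᵇ k then copy r else r) B) k)
    ≡⟨ cong (λ X → map (λ r → del r k) (del X k)) (imapFrom-if copy (λ r → r) k 0 B1 (rk ∷ B2) refl) ⟩
  map (λ r → del r k) (del (map copy B1 ++ map (λ r → r) (rk ∷ B2)) k)
    ≡⟨ cong (λ X → map (λ r → del r k) (del (map copy B1 ++ X) k)) (map-id (rk ∷ B2)) ⟩
  map (λ r → del r k) (del (map copy B1 ++ rk ∷ B2) k)
    ≡⟨ cong (map (λ r → del r k)) (del-mid (map copy B1) rk B2 (length-map copy B1)) ⟩
  map (λ r → del r k) (map copy B1 ++ B2)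
    ≡⟨ map-++ (λ r → del r k) (map copy B1) B2 ⟩
  map (λ r → del r k) (map copy B1) ++ map (λ r → del r k) B2
    ≡⟨ cong (_++ map (λ r → del r k) B2) (sym (map-∘ B1)) ⟩
  map (moveIntoLast k e) B1 ++ map (λ r → del r k) B2 ∎
  where
    B = B1 ++ rk ∷ B2
    copy = λ r → upd r e (const (get r k))

ψ≡ : ∀ A {B i} → f A ≡ B → index A ≡ suc i → ψ A ≡ (B , i)
ψ≡ A fA ix = cong₂ _,_ fA (cong (_∸ 1) ix)

unitRow-pos : ∀ m → 0 < get (unitRow m) m
unitRow-pos m = subst (0 <_) (sym (get-unitRow m)) z<s

ψ∘add1 : ∀ {e} (B : Mat) i → dim B ≡ suc e → Width (suc e) B → i < dim B → i < index B →
  (∀ p → p < i → get (getRow B p) e ≡ 0) →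
  0 < get (getRow B i) e ⊎ (get (getRow B i) e ≡ 0 × i < e × otherPos (getRow B i) e ≡ true) →
  ψ (add B i) ≡ (B , i)
ψ∘add1 {e} B i d width i<d i<ix above cond with split-at B i i<d
... | Ba , ri , Bc , refl , refl = trans (cong ψ addB) (ψ≡ A fA ixA)
  where
    ri⁺ = upd ri e suc
    A = Ba ++ ri⁺ ∷ Bc
    addB : add B i ≡ A
    addB = trans (add≡add1 i<ix) (trans (cong (λ d → upd B i (λ r → upd r (d ∸ 1) suc)) d) (upd-mid Ba ri Bc _))
    dA : dim A ≡ suc e
    dA = trans (length-mid Ba ri⁺ ri Bc) d
    zeros : ColumnZero e Ba
    zeros = All-getRow⁺ Ba (λ p p<i → trans (cong (λ r → get r e) (sym (getRow-++ˡ Ba (ri ∷ Bc) p p<i))) (above p p<i))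
    getRow-i : getRow B i ≡ ri
    getRow-i = getRow-mid Ba ri Bc refl
    ri⁺-e : get ri⁺ e ≡ suc (get ri e)
    ri⁺-e = get-upd ri e suc (subst (e <_) (sym (subst (λ r → length r ≡ suc e) getRow-i (All-getRow B i width i<d))) ≤-refl)
    pos : 0 < get ri⁺ e
    pos = subst (0 <_) (sym ri⁺-e) z<s
    ixA : index A ≡ suc i
    ixA = index-pivot Ba ri⁺ Bc dA zeros pos
    vA : val A ≡ suc (get ri e)
    vA = trans (val-pivot Ba ri⁺ Bc dA zeros pos) ri⁺-e
    isRem1 : 1 < val A ⊎ (val A ≡ 1 × i < e × otherPos (getRow A i) e ≡ true)
    isRem1 = Sum.map
      (λ ri-pos → subst (1 <_) (sym vA) (s<s (subst (0 <_) (cong (λ r → get r e) getRow-i) ri-pos)))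
      (λ { (ri-0 , i<e , other) →
           trans vA (cong suc (trans (cong (λ r → get r e) (sym getRow-i)) ri-0)) , i<e ,
           trans (cong (λ r → otherPos r e) (getRow-mid Ba ri⁺ Bc refl))
                 (trans (otherPos-upd ri e suc) (trans (cong (λ r → otherPos r e) (sym getRow-i)) other)) })
      cond
    fA : f A ≡ B
    fA = begin
      f A                           ≡⟨ f≡rem1 A ixA dA isRem1 ⟩
      rem1 A                        ≡⟨ cong₂ (λ i d → upd A (i ∸ 1) (λ r → upd r (d ∸ 1) pred)) ixA dA ⟩
      upd A i (λ r → upd r e pred)  ≡⟨ upd-mid Ba ri⁺ Bc _ ⟩
      Ba ++ upd ri⁺ e pred ∷ Bc     ≡⟨ cong (λ r → Ba ++ r ∷ Bc) (trans (upd-upd ri e suc pred) (upd-fix ri e _ refl)) ⟩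
      B                             ∎

ψ∘add2 : ∀ {e} (B : Mat) → dim B ≡ suc e → Width (suc e) B → index B ≤ suc e →
  ψ (add B (suc e)) ≡ (B , suc e)
ψ∘add2 {e} B d width ix≤ = trans (cong ψ addB) (ψ≡ A fA ixA)
  where
    padded = map (_++ [ 0 ]) B
    A = padded ++ [ unitRow (suc e) ]
    addB : add B (suc e) ≡ A
    addB = subst (λ d → add B d ≡ map (_++ [ 0 ]) B ++ [ unitRow d ]) d (add≡add2 (subst (index B ≤_) (sym d) ix≤))
    length-padded : length padded ≡ suc e
    length-padded = trans (length-map _ B) d
    dA : dim A ≡ suc (suc e)
    dA = trans (length-snoc padded _) (cong suc length-padded)
    zeros : ColumnZero (suc e) padded
    zeros = map⁺ (All.map (λ {r} → get-mid r 0 []) width)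
    ixA : index A ≡ suc (suc e)
    ixA = trans (index-pivot padded _ [] dA zeros (unitRow-pos (suc e))) (cong suc length-padded)
    vA : val A ≡ 1
    vA = trans (val-pivot padded _ [] dA zeros (unitRow-pos (suc e))) (get-unitRow (suc e))
    fA : f A ≡ B
    fA = begin
      f A                                        ≡⟨ f≡rem2 A vA ixA dA ⟩
      rem2 A                                     ≡⟨ cong (λ d → map (take (d ∸ 1)) (take (d ∸ 1) A)) dA ⟩
      map (take (suc e)) (take (suc e) A)        ≡⟨ cong (map (take (suc e))) (take-++ padded _ length-padded) ⟩
      map (take (suc e)) padded                  ≡⟨ sym (map-∘ B) ⟩
      map (take (suc e) ∘ (_++ [ 0 ])) B         ≡⟨ map-id-local (All.map (λ {r} → take-++ r [ 0 ]) width) ⟩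
      B                                          ∎

ψ∘add3 : ∀ {e} (B : Mat) i → dim B ≡ suc e → Width (suc e) B → index B ≤ i → i ≤ e →
  ψ (add B i) ≡ (B , i)
ψ∘add3 {e} B i d width ix≤i i≤e with split-≤ B i (≤-trans i≤e (≤-trans (n≤1+n e) (≤-reflexive (sym d))))
... | Ba , Bc , refl , refl = trans (cong ψ addB) (ψ≡ A fA ixA)
  where
    above = map (moveLastInto i e) Ba
    below = map (insertAt i 0) Bc
    A = above ++ unitRow (suc e) ∷ below
    addB : add B i ≡ A
    addB = trans (add≡add3 ix≤i (subst (i <_) (sym d) (s≤s i≤e))) (add3-split Ba Bc refl d)
    length-above : length above ≡ i
    length-above = length-map _ Ba
    dA : dim A ≡ suc (suc e)
    dA = begin
      length (above ++ unitRow (suc e) ∷ below)  ≡⟨ length-++ above ⟩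
      length above + suc (length below)          ≡⟨ cong₂ (λ a b → a + suc b) length-above (length-map _ Bc) ⟩
      i + suc (length Bc)                        ≡⟨ +-suc i (length Bc) ⟩
      suc (i + length Bc)                        ≡⟨ cong suc (trans (sym (length-++ Ba)) d) ⟩
      suc (suc e)                                ∎
    width-Ba = ++⁻ˡ Ba width
    width-Bc = ++⁻ʳ Ba width
    zeros : ColumnZero (suc e) above
    zeros = map⁺ (All.map (λ {r} lr → get-moveLastInto r i e i≤e (subst (e <_) (sym lr) ≤-refl)) width-Ba)
    ixA : index A ≡ suc i
    ixA = trans (index-pivot above _ below dA zeros (unitRow-pos (suc e))) (cong suc length-above)
    vA : val A ≡ 1
    vA = trans (val-pivot above _ below dA zeros (unitRow-pos (suc e))) (get-unitRow (suc e))
    other : otherPos (getRow A i) (suc e) ≡ false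
    other = trans (cong (λ r → otherPos r (suc e)) (getRow-mid above _ below length-above)) (otherPos-unitRow (suc e))
    fA : f A ≡ B
    fA = begin
      f A                                                              ≡⟨ f≡rem3 A vA ixA dA (s≤s i≤e) other ⟩
      rem3 A                                                           ≡⟨ rem3-split above (unitRow (suc e)) below length-above ixA dA ⟩
      map (moveIntoLast i (suc e)) above ++ map (λ r → del r i) below  ≡⟨ cong₂ _++_ (sym (map-∘ Ba)) (sym (map-∘ Bc)) ⟩
      map (moveIntoLast i (suc e) ∘ moveLastInto i e) Ba ++ map ((λ r → del r i) ∘ insertAt i 0) Bc
        ≡⟨ cong₂ _++_
             (map-id-local (All.map (λ {r} lr → moveIntoLast-moveLastInto r i e i≤e (subst (e <_) (sym lr) ≤-refl)) width-Ba))
             (map-id-local (All.map (λ {r} lr → del-insertAt r i 0 (subst (i ≤_) (sym lr) (m≤n⇒m≤1+n i≤e))) width-Bc)) ⟩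
      Ba ++ Bc                                                         ∎

data PivotSplit (e : ℕ) : Mat → Set where
  pivotSplit : ∀ B1 rk B2 → ColumnZero e B1 → 0 < get rk e → PivotSplit e (B1 ++ rk ∷ B2)

pivotSplit-of : ∀ e (B : Mat) p → p < length B → 0 < get (getRow B p) e → PivotSplit e B
pivotSplit-of e (r ∷ B) zero    _         pos = pivotSplit [] r B [] pos
pivotSplit-of e (r ∷ B) (suc p) (s≤s p<n) pos with get r e in eq
... | suc _ = pivotSplit [] r B [] (subst (0 <_) (sym eq) z<s)
... | zero with pivotSplit-of e B p p<n pos
...   | pivotSplit B1 rk B2 zeros rk-pos = pivotSplit (r ∷ B1) rk B2 (eq ∷ zeros) rk-pos

width-of : ∀ {n e B} → InInt n B → dim B ≡ suc e → Width (suc e) B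
width-of B∈ d = All.map (λ eq → trans eq d) (InInt.square B∈)

module _ {n : ℕ} (B1 : Mat) (rk : List ℕ) (B2 : Mat) (B∈ : InInt n (B1 ++ rk ∷ B2)) where
  private
    B = B1 ++ rk ∷ B2
    k = length B1

  pivot<dim : k < dim B
  pivot<dim = subst (k <_) (sym (length-++ B1)) (m<m+n k z<s)

  pivotRow-lower : ∀ q → q < k → get rk q ≡ 0
  pivotRow-lower q q<k =
    trans (cong (λ r → get r q) (sym (getRow-mid B1 rk B2 refl))) (InInt.upperTri B∈ k q pivot<dim q<k)

  belowPivot-zero : ColumnZero k B2
  belowPivot-zero = All-getRow⁺ B2 λ j j<n →
    trans (cong (λ r → get r k) (sym (getRow-++ʳ B1 (rk ∷ B2) (suc j))))
          (InInt.upperTri B∈ (k + suc j) k (subst (k + suc j <_) (sym (length-++ B1)) (+-monoʳ-< k (s<s j<n)))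
                                           (m<m+n k z<s))

  abovePivot-zero : ∀ {e} → ColumnZero e B1 → ∀ p → p < k → get (getRow B p) e ≡ 0
  abovePivot-zero {e} zeros p p<k = trans (cong (λ r → get r e) (getRow-++ˡ B1 (rk ∷ B2) p p<k)) (All-getRow B1 p zeros p<k)

  -- Column q is nonzero; its positive entry is not in the pivot row and, by upper triangularity, not below it.
  positive-abovePivot : ∀ q → q ≤ k → get rk q ≡ 0 → Σ ℕ λ p → p < k × 0 < get (getRow B1 p) q
  positive-abovePivot q q≤k rk-q with InInt.colNonzero B∈ q (≤-<-trans q≤k pivot<dim)
  ... | p , p<d , pos with <-cmp p k
  ...   | tri< p<k _ _ = p , p<k , subst (0 <_) (cong (λ r → get r q) (getRow-++ˡ B1 (rk ∷ B2) p p<k)) pos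
  ...   | tri≈ _ refl _ = contradiction (trans (cong (λ r → get r q) (getRow-mid B1 rk B2 refl)) rk-q) (>⇒≢ pos)
  ...   | tri> _ _ k<p = contradiction (InInt.upperTri B∈ p q p<d (≤-<-trans q≤k k<p)) (>⇒≢ pos)

  -- A removal that carries column q of the rows above the pivot into the new last column
  -- leaves a matrix of index at most index B ∸ 1.
  index-≤-pivot : ∀ {e'} q (h : List ℕ → List ℕ) N2 → q ≤ k → get rk q ≡ 0 →
    All (λ r → get (h r) e' ≡ get r q) B1 → dim (map h B1 ++ N2) ≡ suc e' → index (map h B1 ++ N2) ≤ k
  index-≤-pivot {e'} q h N2 q≤k rk-q moved dC with positive-abovePivot q q≤k rk-q
  ... | p , p<k , p-pos = ≤-trans (index-≤ C p dC p<dC (subst (0 <_) (sym rowC) p-pos)) p<k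
    where
      C = map h B1 ++ N2
      p<hB1 : p < length (map h B1)
      p<hB1 = subst (p <_) (sym (length-map h B1)) p<k
      p<dC : p < dim C
      p<dC = <-≤-trans p<hB1 (length-++-≤ˡ (map h B1))
      rowC : get (getRow C p) e' ≡ get (getRow B1 p) q
      rowC = trans (cong (λ r → get r e') (trans (getRow-++ˡ (map h B1) N2 p p<hB1) (getRow-map h B1 p p<k)))
                   (All-getRow B1 p moved p<k)

add∘rem1 : ∀ {e} (B1 : Mat) rk B2 → dim (B1 ++ rk ∷ B2) ≡ suc e → ColumnZero e B1 → 0 < get rk e →
  1 < get rk e ⊎ (get rk e ≡ 1 × length B1 < e × otherPos rk e ≡ true) →
  add (f (B1 ++ rk ∷ B2)) (length B1) ≡ B1 ++ rk ∷ B2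
add∘rem1 {e} B1 rk B2 d zeros pos cond = begin
  add (f B) k                             ≡⟨ cong (λ A → add A k) fB ⟩
  add C k                                 ≡⟨ add≡add1 k<ixC ⟩
  upd C k (λ r → upd r (dim C ∸ 1) suc)   ≡⟨ cong (λ d → upd C k (λ r → upd r (d ∸ 1) suc)) dC ⟩
  upd C k (λ r → upd r e suc)             ≡⟨ upd-mid B1 rk⁻ B2 _ ⟩
  B1 ++ upd rk⁻ e suc ∷ B2                ≡⟨ cong (λ r → B1 ++ r ∷ B2) (upd-upd rk e pred suc) ⟩
  B1 ++ upd rk e (suc ∘ pred) ∷ B2        ≡⟨ cong (λ r → B1 ++ r ∷ B2) (upd-fix rk e _ (suc-pred _ {{>-nonZero pos}})) ⟩
  B                                       ∎
  where
    B = B1 ++ rk ∷ B2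
    k = length B1
    rk⁻ = upd rk e pred
    C = B1 ++ rk⁻ ∷ B2
    ixB : index B ≡ suc k
    ixB = index-pivot B1 rk B2 d zeros pos
    vB : val B ≡ get rk e
    vB = val-pivot B1 rk B2 d zeros pos
    isRem1 : 1 < val B ⊎ (val B ≡ 1 × k < e × otherPos (getRow B k) e ≡ true)
    isRem1 = Sum.map (subst (1 <_) (sym vB))
      (λ { (one , k<e , other) → trans vB one , k<e , trans (cong (λ r → otherPos r e) (getRow-mid B1 rk B2 refl)) other })
      cond
    fB : f B ≡ C
    fB = trans (f≡rem1 B ixB d isRem1)
               (trans (cong₂ (λ i d → upd B (i ∸ 1) (λ r → upd r (d ∸ 1) pred)) ixB d) (upd-mid B1 rk B2 _))
    dC : dim C ≡ suc e
    dC = trans (length-mid B1 rk⁻ rk B2) d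
    k<ixC : k < index C
    k<ixC = subst (k <_) (sym (index-above B1 (rk⁻ ∷ B2) dC zeros)) (s≤s (m≤m+n k _))

-- If the pivot row is the only row, B = [[1]] and n = 1.
add∘rem2 : ∀ {n e} (B1 : Mat) rk B2 → InInt n (B1 ++ rk ∷ B2) → 1 < n → length B1 ≡ e →
  dim (B1 ++ rk ∷ B2) ≡ suc e → ColumnZero e B1 → get rk e ≡ 1 → add (f (B1 ++ rk ∷ B2)) e ≡ B1 ++ rk ∷ B2
add∘rem2 B1 rk (r ∷ B2) _ _ refl d _ _ =
  contradiction (suc-injective (trans (sym (+-suc (length B1) (suc (length B2)))) (trans (sym (length-++ B1)) d)))
                (m+1+n≢m (length B1))
add∘rem2 [] rk [] B∈ 1<n refl d _ one with width-of B∈ d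
... | lr ∷ [] = contradiction (trans (cong (λ r → sum (map sum [ r ])) (sym rk≡)) (InInt.sumIs B∈)) (<⇒≢ 1<n)
  where
    rk≡ : rk ≡ unitRow 0
    rk≡ = ≡unitRow rk 0 lr (λ _ ()) one
add∘rem2 {e = e} B1@(_ ∷ B1') rk [] B∈ 1<n refl d zeros one = begin
  add (f B) e                                       ≡⟨ cong (λ A → add A e) fB ⟩
  add C e                                           ≡⟨ addC ⟩
  map (_++ [ 0 ]) C ++ [ unitRow e ]                ≡⟨ cong₂ (λ X r → X ++ [ r ]) restoreColumn (sym rk≡) ⟩
  B                                                 ∎
  where
    e' = length B1'
    B = B1 ++ rk ∷ []
    C = map (take e) B1
    width = width-of B∈ d
    width1 = ++⁻ˡ B1 width
    pos : 0 < get rk e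
    pos = subst (0 <_) (sym one) z<s
    rk≡ : rk ≡ unitRow e
    rk≡ with ++⁻ʳ B1 width
    ... | lr ∷ [] = ≡unitRow rk e lr (pivotRow-lower B1 rk [] B∈) one
    fB : f B ≡ C
    fB = begin
      f B                                         ≡⟨ f≡rem2 B (trans (val-pivot B1 rk [] d zeros pos) one) (index-pivot B1 rk [] d zeros pos) d ⟩
      map (take (dim B ∸ 1)) (take (dim B ∸ 1) B) ≡⟨ cong (λ d → map (take (d ∸ 1)) (take (d ∸ 1) B)) d ⟩
      map (take e) (take e B)                     ≡⟨ cong (map (take e)) (take-++ B1 _ refl) ⟩
      C                                           ∎
    dC : dim C ≡ e
    dC = length-map _ B1
    ixC≤ : index C ≤ e
    ixC≤ = subst (λ X → index X ≤ e) (++-identityʳ C)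
      (index-≤-pivot B1 rk [] B∈ e' (take e) [] (n≤1+n e') (pivotRow-lower B1 rk [] B∈ e' ≤-refl)
         (All.universal (λ r → get-take r e e' ≤-refl) B1) (trans (cong length (++-identityʳ C)) dC))
    addC : add C e ≡ map (_++ [ 0 ]) C ++ [ unitRow e ]
    addC = subst (λ d → add C d ≡ map (_++ [ 0 ]) C ++ [ unitRow d ]) dC (add≡add2 (subst (index C ≤_) (sym dC) ixC≤))
    restoreColumn : map (_++ [ 0 ]) C ≡ B1
    restoreColumn = trans (sym (map-∘ B1))
      (map-id-local (All.zipWith (λ { {r} (lr , last0) → take-∷ʳ-last r e lr last0 }) (width1 , zeros)))

add∘rem3 : ∀ {n e} (B1 : Mat) rk B2 → InInt n (B1 ++ rk ∷ B2) → dim (B1 ++ rk ∷ B2) ≡ suc e →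
  length B1 < e → ColumnZero e B1 → get rk e ≡ 1 → otherPos rk e ≡ false →
  add (f (B1 ++ rk ∷ B2)) (length B1) ≡ B1 ++ rk ∷ B2
add∘rem3 {e = suc e'} B1 rk B2 B∈ d k<e@(s≤s k≤e') zeros one other = begin
  add (f B) k                                                           ≡⟨ cong (λ A → add A k) fB ⟩
  add C k                                                               ≡⟨ add≡add3 ixC≤ (subst (k <_) (sym dC) (s≤s k≤e')) ⟩
  add3 (N1 ++ N2) k                                                     ≡⟨ add3-split N1 N2 (length-map _ B1) dC ⟩
  map (moveLastInto k e') N1 ++ unitRow e ∷ map (insertAt k 0) N2      ≡⟨ cong₂ (λ X Y → X ++ unitRow e ∷ Y) (sym (map-∘ B1)) (sym (map-∘ B2)) ⟩
  map (moveLastInto k e' ∘ moveIntoLast k e) B1 ++ unitRow e ∷ map (insertAt k 0 ∘ (λ r → del r k)) B2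
    ≡⟨ cong₃ restoreAbove (sym rk≡) restoreBelow ⟩
  B                                                                     ∎
  where
    e = suc e'
    B = B1 ++ rk ∷ B2
    k = length B1
    N1 = map (moveIntoLast k e) B1
    N2 = map (λ r → del r k) B2
    C = N1 ++ N2
    width = width-of B∈ d
    width1 = ++⁻ˡ B1 width
    pos : 0 < get rk e
    pos = subst (0 <_) (sym one) z<s
    ixB : index B ≡ suc k
    ixB = index-pivot B1 rk B2 d zeros pos
    fB : f B ≡ C
    fB = trans (f≡rem3 B (trans (val-pivot B1 rk B2 d zeros pos) one) ixB d k<e
                 (trans (cong (λ r → otherPos r e) (getRow-mid B1 rk B2 refl)) other))
               (rem3-split B1 rk B2 refl ixB d)
    rk≡ : rk ≡ unitRow e
    rk≡ with ++⁻ʳ B1 width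
    ... | lr ∷ _ = ≡unitRow rk e lr (λ q q<e → otherPos-elim rk q e (<⇒≢ q<e) other) one
    dC : dim C ≡ e
    dC = begin
      length (N1 ++ N2)          ≡⟨ length-++ N1 ⟩
      length N1 + length N2      ≡⟨ cong₂ _+_ (length-map _ B1) (length-map _ B2) ⟩
      k + length B2              ≡⟨ suc-injective (trans (sym (+-suc k (length B2))) (trans (sym (length-++ B1)) d)) ⟩
      e                          ∎
    ixC≤ : index C ≤ k
    ixC≤ = index-≤-pivot B1 rk B2 B∈ k (moveIntoLast k e) N2 ≤-refl (otherPos-elim rk k e (<⇒≢ k<e) other)
      (All.map (λ {r} lr → get-moveIntoLast r k e' k≤e' (subst (e <_) (sym lr) ≤-refl)) width1) dC
    restoreAbove : map (moveLastInto k e' ∘ moveIntoLast k e) B1 ≡ B1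
    restoreAbove = map-id-local (All.zipWith
      (λ { {r} (lr , last0) → moveLastInto-moveIntoLast r k e' k≤e' (subst (e <_) (sym lr) ≤-refl) last0 }) (width1 , zeros))
    restoreBelow : map (insertAt k 0 ∘ (λ r → del r k)) B2 ≡ B2
    restoreBelow with ++⁻ʳ B1 width
    ... | _ ∷ width2 = map-id-local (All.zipWith
      (λ { {r} (lr , col0) → insertAt-del r k (subst (k <_) (sym lr) (<-trans k<e (n<1+n e))) col0 })
      (width2 , belowPivot-zero B1 rk B2 B∈))
    cong₃ : ∀ {X X' : Mat} {r r' : List ℕ} {Y Y' : Mat} → X ≡ X' → r ≡ r' → Y ≡ Y' → X ++ r ∷ Y ≡ X' ++ r' ∷ Y'
    cong₃ refl refl refl = refl

module _ {n e : ℕ} (B1 : Mat) (rk : List ℕ) (B2 : Mat) (B∈ : InInt n (B1 ++ rk ∷ B2))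
         (d : dim (B1 ++ rk ∷ B2) ≡ suc e) (zeros : ColumnZero e B1) (pos : 0 < get rk e) where
  private
    B = B1 ++ rk ∷ B2
    k = length B1
    width = width-of B∈ d
    k<d : k < dim B
    k<d = pivot<dim B1 rk B2 B∈
    k≤e : k ≤ e
    k≤e = ≤-pred (subst (k <_) d k<d)
    ixB : index B ≡ suc k
    ixB = index-pivot B1 rk B2 d zeros pos
    above : ∀ p → p < k → get (getRow B p) e ≡ 0
    above = abovePivot-zero B1 rk B2 B∈ zeros

  ψ∘add-pivot : ∀ i → i ≤ dim B → ψ (add B i) ≡ (B , i)
  ψ∘add-pivot i i≤d with <-cmp i k
  ... | tri< i<k _ _ = ψ∘add1 B i d width (<-trans i<k k<d) (subst (i <_) (sym ixB) (m<n⇒m<1+n i<k))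
                         (λ p p<i → above p (<-trans p<i i<k)) (inj₂ (above i i<k , ≤-trans i<k k≤e , other))
    where
      other : otherPos (getRow B i) e ≡ true
      other with InInt.rowNonzero B∈ i (<-trans i<k k<d)
      ... | q , _ , q-pos = otherPos-intro (getRow B i) q e (λ { refl → >⇒≢ q-pos (above i i<k) }) q-pos
  ... | tri≈ _ refl _ = ψ∘add1 B i d width k<d (subst (i <_) (sym ixB) ≤-refl) above
                          (inj₁ (subst (λ r → 0 < get r e) (sym (getRow-mid B1 rk B2 refl)) pos))
  ... | tri> _ _ k<i with m≤n⇒m<n∨m≡n (subst (i ≤_) d i≤d)
  ...   | inj₁ i<d = ψ∘add3 B i d width (subst (_≤ i) (sym ixB) k<i) (≤-pred i<d)
  ...   | inj₂ refl = ψ∘add2 B d width (subst (_≤ suc e) (sym ixB) k<i)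

  add∘ψ-pivot : 1 < n → addP (ψ B) ≡ B
  add∘ψ-pivot 1<n = trans (cong (λ i → add (f B) (i ∸ 1)) ixB) (by-val (<-cmp 1 (get rk e)))
    where
      by-val : Tri (1 < get rk e) (1 ≡ get rk e) (get rk e < 1) → add (f B) k ≡ B
      by-val (tri< 1<v _ _) = add∘rem1 B1 rk B2 d zeros pos (inj₁ 1<v)
      by-val (tri> _ _ v<1) = contradiction pos (<⇒≱ v<1)
      by-val (tri≈ _ one _) with m≤n⇒m<n∨m≡n k≤e | otherPos rk e in other
      ... | inj₁ k<e  | true  = add∘rem1 B1 rk B2 d zeros pos (inj₂ (sym one , k<e , other))
      ... | inj₁ k<e  | false = add∘rem3 B1 rk B2 B∈ d k<e zeros (sym one) other
      ... | inj₂ refl | _     = add∘rem2 B1 rk B2 B∈ 1<n refl d zeros (sym one)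

dim-suc : ∀ {n} (B : Mat) → InInt n B → 1 ≤ n → Σ ℕ λ e → dim B ≡ suc e
dim-suc []      B∈ 1≤n = contradiction (InInt.sumIs B∈) (<⇒≢ 1≤n)
dim-suc (r ∷ B) _  _   = length B , refl

pivotSplit-in : ∀ {n e} (B : Mat) → InInt n B → dim B ≡ suc e → PivotSplit e B
pivotSplit-in {e = e} B B∈ d with InInt.colNonzero B∈ e (subst (e <_) (sym d) ≤-refl)
... | p , p<d , pos = pivotSplit-of e B p p<d pos

mainTheorem3 : ∀ (n : ℕ) → 1 ≤ n → ∀ (B : Mat) → InInt n B →
    (∀ (i : ℕ) → i ≤ dim B → ψ (add B i) ≡ (B , i))
    × (1 < n → addP (ψ B) ≡ B)
mainTheorem3 n 1≤n B B∈ with dim-suc B B∈ 1≤n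
... | e , d with pivotSplit-in B B∈ d
...   | pivotSplit B1 rk B2 zeros pos = ψ∘add-pivot B1 rk B2 B∈ d zeros pos , add∘ψ-pivot B1 rk B2 B∈ d zeros pos
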